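{- Let $n\ge1$ and $q\ge2$ be integers. (1) Every RK puzzle in $\mathrm{RK}^{ -1/q}_n$ has a unique solution if $n\le q^2+2q-3$; equivalently, $k_{q^2+2q-3}\preceq-\frac1q$. (2) Every RK puzzle in $\mathrm{RK}^{ -q}_n$ has a unique solution if $n\le q^2+2q-2$; equivalently, $k_{q^2+2q-2}\preceq-q$. (3) Every RK puzzle in $\mathrm{RK}^{1/q}_n$ has a unique solution if $n\le q^2+3q-2$; equivalently, $k_{q^2+3q-2}\preceq\frac1q$. (4) Every RK puzzle in $\mathrm{RK}^{q}_n$ has a unique solution if $n\le q^2+3q-1$; equivalently, $k_{q^2+3q-1}\preceq q$.
   Context: For a positive integer $n$ let $I_n=\{1,\dots,n\}$ and $I_{n,n}=I_n\times I_n\subset\mathbb{R}^2$. For a slope $s\in\mathbb{Q}\cup\{\infty\}$ let $\mathscr{L}_s$ be the set of lines of slope $s$ meeting $I_{n,n}$, and for $\ell\in\mathscr{L}_s$ let $P_{\ell,s}(X)=\sum_{(i,j)\in\ell\cap I_{n,n}}X_{i,j}$. An $n\times n$ RK puzzle with finite slope set $T$ is a system consisting of one equation $P_{\ell,t}(X)=c_{\ell,t}$ (arbitrary $c_{\ell,t}\in\mathbb{R}$) for each $t\in T$, $\ell\in\mathscr{L}_t$; solutions are real solutions; solvable means having a solution. Slope order: $S=\mathbb{Z}\cup\{1/k:k\in\mathbb{Z}\}$ with $1/0:=\infty$, totally ordered by $0\prec\infty\prec-1\prec1\prec-\frac12\prec-2\prec\frac12\prec2\prec-\frac13\prec-3\prec\frac13\prec3\prec\cdots$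 (after $0,\infty,-1,1$, for each $k=2,3,\dots$ in turn come $-\frac1k\prec-k\prec\frac1k\prec k$). For $s\in S$, $\mathrm{RK}^s_n$ is the family of all solvable $n\times n$ RK puzzles with slope set $\{t\in S:t\preceq s\}$, and $k_n$ is the smallest $s\in S$ (w.r.t. $\prec$) such that every RK puzzle in $\mathrm{RK}^s_n$ has a unique solution. -}

module Defs where

open import Level using (0ℓ)
open import Data.Nat as ℕ using (ℕ; zero; suc)
open import Data.Integer as ℤ using (ℤ; +_; -[1+_]; _-_; _≟_)
open import Data.Fin using (Fin; toℕ)
open import Data.Product using (∃; _×_; _,_)
open import Data.Bool using (if_then_else_)
open import Relation.Nullary using (¬_)
open import Relation.Nullary.Decidable using (⌊_⌋)
open import Relation.Binary using (Rel; IsTotalOrder)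
open import Relation.Binary.PropositionalEquality using (_≡_)
open import Algebra.Bundles using (CommutativeRing)

-- The real numbers, axiomatised as a Dedekind-complete ordered field
-- (unique up to isomorphism).  The agda-stdlib has no reals.

record RealField : Set₁ where
  field
    commRing : CommutativeRing 0ℓ 0ℓ
  open CommutativeRing commRing public
  field
    _≤_          : Rel Carrier 0ℓ
    isTotalOrder : IsTotalOrder _≈_ _≤_
    0≉1          : ¬ (0# ≈ 1#)
    inverse      : ∀ x → ¬ (x ≈ 0#) → ∃ λ y → (x * y) ≈ 1#
    +-monoˡ-≤    : ∀ {x y} z → x ≤ y → (x + z) ≤ (y + z)
    *-nonneg     : ∀ {x y} → 0# ≤ x → 0# ≤ y → 0# ≤ (x * y)
    lub : (P : Carrier → Set) → ∃ P → (∃ λ b → ∀ x → P x → x ≤ b) →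
          ∃ λ s → (∀ x → P x → x ≤ s) × (∀ b → (∀ x → P x → x ≤ b) → s ≤ b)

-- Slopes in S = ℤ ∪ {1/k : k ∈ ℤ}, with 1/0 = ∞.
-- intS k is the slope k, invS k is the slope 1/k.
-- (intS 1 / invS 1 and intS -1 / invS -1 denote the same slope; they get
-- the same rank and define the same lines.)

data Slope : Set where
  intS : ℤ → Slope
  invS : ℤ → Slope

-- position in the order 0 ≺ ∞ ≺ -1 ≺ 1 ≺ -1/2 ≺ -2 ≺ 1/2 ≺ 2 ≺ -1/3 ≺ ...
-- (for k ≥ 2: -1/k ↦ 4k-4, -k ↦ 4k-3, 1/k ↦ 4k-2, k ↦ 4k-1)
rank : Slope → ℕ
rank (intS (+ zero))          = 0
rank (intS (+ suc zero))      = 3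
rank (intS (+ suc (suc m)))   = 4 ℕ.* m ℕ.+ 7
rank (intS -[1+ zero ])       = 2
rank (intS -[1+ suc m ])      = 4 ℕ.* m ℕ.+ 5
rank (invS (+ zero))          = 1
rank (invS (+ suc zero))      = 3
rank (invS (+ suc (suc m)))   = 4 ℕ.* m ℕ.+ 6
rank (invS -[1+ zero ])       = 2
rank (invS -[1+ suc m ])      = 4 ℕ.* m ℕ.+ 4

_⪯_ : Slope → Slope → Set
t ⪯ s = rank t ℕ.≤ rank s

-- Lines of slope t are the level sets of the integer functional
-- lineIndex t : slope k ↦ k·x − y,  slope 1/k ↦ x − k·y  (so ∞ ↦ x).
lineIndex : Slope → ℤ → ℤ → ℤ
lineIndex (intS k) x y = k ℤ.* x - y
lineIndex (invS k) x y = x - k ℤ.* y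

-- The grid I_{n,n}: cell (i , j) : Fin n × Fin n is the point (1+i , 1+j).

coord : ∀ {n} → Fin n → ℤ
coord i = + suc (toℕ i)

lineOf : ∀ {n} → Slope → Fin n → Fin n → ℤ
lineOf t i j = lineIndex t (coord i) (coord j)

Meets : ℕ → Slope → ℤ → Set
Meets n t v = ∃ λ (i : Fin n) → ∃ λ (j : Fin n) → lineOf t i j ≡ v

module _ (R : RealField) where
  open RealField R

  sumFin : ∀ {m} → (Fin m → Carrier) → Carrier
  sumFin {zero}  f = 0#
  sumFin {suc m} f = f Fin.zero + sumFin (λ i → f (Fin.suc i))
    where import Data.Fin as Fin

  lineSum : ∀ {n} → (Fin n → Fin n → Carrier) → Slope → ℤ → Carrier
  lineSum X t v =
    sumFin (λ i → sumFin (λ j → if ⌊ lineOf t i j ≟ v ⌋ then X i j else 0#))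

  Solves : (n : ℕ) (s : Slope) (c : Slope → ℤ → Carrier) →
           (Fin n → Fin n → Carrier) → Set
  Solves n s c X = ∀ t → t ⪯ s → ∀ v → Meets n t v → lineSum X t v ≈ c t v

  -- every puzzle in RK^s_n has a unique solution:
  -- every solvable such puzzle has at most (hence exactly) one solution
  AllUnique : ℕ → Slope → Set
  AllUnique n s = ∀ (c : Slope → ℤ → Carrier) (X Y : Fin n → Fin n → Carrier) →
    Solves n s c X → Solves n s c Y → ∀ i j → X i j ≈ Y i j

-- Let D be the difference of two solutions, extended by zero to ℤ²; all its line sums along the
-- slopes t ⪯ s vanish. Each such slope except ∞ has a step (a, b), a ≥ 1, along its lines.
-- Peeling off one slope: if f lives in the columns 1 … W and its line sums along d = (a, b)
-- vanish, put G (x , y) = Σₘ f ((x , y) - m (a , b)) for x ≤ W - a and G = 0 elsewhere. Then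
-- f - (G - G (· - (a , b))) vanishes off the strip W - a < x ≤ W and has zero line sums along d;
-- a line of slope d meets the strip at most once, so f = G - G (· - (a , b)). For another slope e
-- the translation by (a , b) shifts the lines of slope e by δ ≠ 0, so the line sums of G along e
-- are δ-periodic and finitely supported, hence zero. Thus G lives in the columns 1 … W - a and
-- satisfies the hypotheses for the remaining slopes; once W ≤ 0 the function vanishes. Hence the
-- solution is unique as soon as n is at most the sum of the steps a, and for the slopes up to
-- ±q or ±1/q in the order ≺ this sum is exactly the bound in the theorem.
module Submission where

open import Defs
open import Algebra.Bundles using (AbelianGroup)
open import Data.Bool using (Bool; true; false; if_then_else_)
open import Data.Empty using (⊥-elim)
open import Data.Fin as Fin using (Fin; toℕ)
import Data.Fin.Properties as Fin
open import Data.Integer as ℤ using (ℤ; +_; -[1+_]; ∣_∣; 0ℤ)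
import Data.Integer.Properties as ℤ
open import Data.Integer.Tactic.RingSolver using (solve-∀)
open import Data.List using (List; []; _∷_; map; length)
open import Data.List.Relation.Unary.All as All using (All; []; _∷_)
import Data.List.Relation.Unary.All.Properties as All
open import Data.List.Relation.Unary.AllPairs as AllPairs using (AllPairs; []; _∷_)
import Data.List.Relation.Unary.AllPairs.Properties as AllPairs
open import Data.List.Relation.Unary.Linked as Linked using (Linked; []; [-]; _∷_)
open import Data.List.Relation.Unary.Linked.Properties using (Linked⇒AllPairs)
open import Data.Nat as ℕ using (ℕ; zero; suc; z≤n; s≤s)
open import Data.Nat.ListAction using (sum)
import Data.Nat.Properties as ℕ
open import Data.Nat.Tactic.RingSolver using () renaming (solve-∀ to nsolve-∀)
open import Data.Product using (∃-syntax; _×_; _,_; proj₁; proj₂)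
open import Data.Sum using (_⊎_; inj₁; inj₂; [_,_]; [_,_]′)
open import Function using (_∘_)
open import Relation.Binary.Bundles using (Setoid)
open import Relation.Binary.PropositionalEquality as ≡ using (_≡_; _≢_)
open import Relation.Nullary using (¬_; Dec; yes; no)
open import Relation.Nullary.Decidable using (⌊_⌋)

-- Integer arithmetic

i≤j⇒∃[k]i+k≡j : ∀ {i j} → i ℤ.≤ j → ∃[ k ] i ℤ.+ + k ≡ j
i≤j⇒∃[k]i+k≡j {i} {j} i≤j = ∣ j ℤ.- i ∣ , (begin
  i ℤ.+ + ∣ j ℤ.- i ∣  ≡⟨ ≡.cong (ℤ._+_ i) (ℤ.0≤i⇒+∣i∣≡i (ℤ.i≤j⇒0≤j-i i≤j)) ⟩
  i ℤ.+ (j ℤ.- i)      ≡⟨ lemma i j ⟩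
  j                    ∎)
  where
  open ≡.≡-Reasoning
  lemma : ∀ i j → i ℤ.+ (j ℤ.- i) ≡ j
  lemma = solve-∀

open import Algebra.Properties.AbelianGroup ℤ.+-0-abelianGroup
  using () renaming (∙-cancelˡ to +-cancelˡ; ∙-cancelʳ to +-cancelʳ; ⁻¹-anti-homo‿- to neg-−)

+-+-assoc : ∀ i m n → i ℤ.+ + (m ℕ.+ n) ≡ (i ℤ.+ + m) ℤ.+ + n
+-+-assoc i m n = ≡.trans (≡.cong (ℤ._+_ i) (ℤ.pos-+ m n)) (≡.sym (ℤ.+-assoc i (+ m) (+ n)))

length-from-offsets : ∀ i p L r L′ → ((i ℤ.+ + p) ℤ.+ + L) ℤ.+ + r ≡ i ℤ.+ + L′ → L′ ≡ p ℕ.+ (L ℕ.+ r)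
length-from-offsets i p L r L′ eq = ℤ.+-injective (+-cancelˡ i _ _ (begin
  i ℤ.+ + L′                       ≡⟨ eq ⟨
  ((i ℤ.+ + p) ℤ.+ + L) ℤ.+ + r    ≡⟨ ≡.cong (ℤ._+ + r) (+-+-assoc i p L) ⟨
  (i ℤ.+ + (p ℕ.+ L)) ℤ.+ + r      ≡⟨ +-+-assoc i (p ℕ.+ L) r ⟨
  i ℤ.+ + (p ℕ.+ L ℕ.+ r)          ≡⟨ ≡.cong (λ m → i ℤ.+ + m) (ℕ.+-assoc p L r) ⟩
  i ℤ.+ + (p ℕ.+ (L ℕ.+ r))        ∎))
  where open ≡.≡-Reasoning

∣i∣≤n⇒-n≤i : ∀ {i n} → ∣ i ∣ ℕ.≤ n → ℤ.- + n ℤ.≤ i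
∣i∣≤n⇒-n≤i {+ _}      _         = ℤ.neg-≤-pos
∣i∣≤n⇒-n≤i { -[1+ _ ]} (s≤s m≤n) = ℤ.-≤- m≤n

∣i∣≤n⇒i≤n : ∀ {i n} → ∣ i ∣ ℕ.≤ n → i ℤ.≤ + n
∣i∣≤n⇒i≤n {+ _}      m≤n = ℤ.+≤+ m≤n
∣i∣≤n⇒i≤n { -[1+ _ ]} _   = ℤ.-≤+

i<-n⇒n<∣i∣ : ∀ {i n} → i ℤ.< ℤ.- + n → n ℕ.< ∣ i ∣
i<-n⇒n<∣i∣ { -[1+ _ ]} {zero}  _             = s≤s z≤n
i<-n⇒n<∣i∣ { -[1+ _ ]} {suc _} (ℤ.-<- n<m) = s≤s n<m
i<-n⇒n<∣i∣ {+ _}      {zero}  (ℤ.+<+ ())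

n<i⇒n<∣i∣ : ∀ {i n} → + n ℤ.< i → n ℕ.< ∣ i ∣
n<i⇒n<∣i∣ (ℤ.+<+ n<m) = n<m

n<∣i∣⇒i≤0⊎n<i : ∀ {i n} → n ℕ.< ∣ i ∣ → i ℤ.≤ 0ℤ ⊎ + n ℤ.< i
n<∣i∣⇒i≤0⊎n<i {+ _}      n<m = inj₂ (ℤ.+<+ n<m)
n<∣i∣⇒i≤0⊎n<i { -[1+ _ ]} _   = inj₁ ℤ.-≤+

outside-[1,n] : ∀ {i n} → i ℤ.< + 1 ⊎ + 1 ℤ.+ + n ℤ.≤ i → i ℤ.≤ 0ℤ ⊎ + n ℤ.< i
outside-[1,n] (inj₁ i<1)     = inj₁ (ℤ.i<j⇒i≤pred[j] i<1)
outside-[1,n] (inj₂ 1+n≤i)   = inj₂ (ℤ.suc[i]≤j⇒i<j 1+n≤i)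

-R+[1+R+R]≡1+R : ∀ R → ℤ.- + R ℤ.+ + suc (R ℕ.+ R) ≡ + suc R
-R+[1+R+R]≡1+R R = cancel (+ R)
  where cancel : ∀ r → ℤ.- r ℤ.+ (ℤ.1ℤ ℤ.+ (r ℤ.+ r)) ≡ ℤ.1ℤ ℤ.+ r
        cancel = solve-∀

window⊆box : ∀ {S R} s → S ℕ.+ ∣ s ∣ ℕ.≤ R →
             ℤ.- + R ℤ.≤ ℤ.- + S ℤ.+ s ×
             (ℤ.- + S ℤ.+ s) ℤ.+ + suc (S ℕ.+ S) ℤ.≤ ℤ.- + R ℤ.+ + suc (R ℕ.+ R)
window⊆box {S} {R} s S+∣s∣≤R = lower , upper
  where
  open ℤ.≤-Reasoning
  top : ∀ S s → (ℤ.- S ℤ.+ s) ℤ.+ (ℤ.1ℤ ℤ.+ (S ℤ.+ S)) ≡ ℤ.1ℤ ℤ.+ (S ℤ.+ s)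
  top = solve-∀
  lower : ℤ.- + R ℤ.≤ ℤ.- + S ℤ.+ s
  lower = begin
    ℤ.- + R                   ≤⟨ ℤ.neg-mono-≤ (ℤ.+≤+ S+∣s∣≤R) ⟩
    ℤ.- + (S ℕ.+ ∣ s ∣)       ≡⟨ ℤ.neg-distrib-+ (+ S) (+ ∣ s ∣) ⟩
    ℤ.- + S ℤ.+ ℤ.- + ∣ s ∣   ≤⟨ ℤ.+-monoʳ-≤ (ℤ.- + S) (∣i∣≤n⇒-n≤i ℕ.≤-refl) ⟩
    ℤ.- + S ℤ.+ s             ∎
  upper : (ℤ.- + S ℤ.+ s) ℤ.+ + suc (S ℕ.+ S) ℤ.≤ ℤ.- + R ℤ.+ + suc (R ℕ.+ R)
  upper = begin
    (ℤ.- + S ℤ.+ s) ℤ.+ + suc (S ℕ.+ S) ≡⟨ top (+ S) s ⟩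
    ℤ.1ℤ ℤ.+ (+ S ℤ.+ s)                ≤⟨ ℤ.+-monoʳ-≤ ℤ.1ℤ (ℤ.+-monoʳ-≤ (+ S) (∣i∣≤n⇒i≤n {s} ℕ.≤-refl)) ⟩
    + suc (S ℕ.+ ∣ s ∣)                 ≤⟨ ℤ.+≤+ (s≤s S+∣s∣≤R) ⟩
    + suc R                             ≡⟨ -R+[1+R+R]≡1+R R ⟨
    ℤ.- + R ℤ.+ + suc (R ℕ.+ R)         ∎

∣i∣≤∣i-j∣+∣j∣ : ∀ i j → ∣ i ∣ ℕ.≤ ∣ i ℤ.- j ∣ ℕ.+ ∣ j ∣
∣i∣≤∣i-j∣+∣j∣ i j = ≡.subst (λ k → ∣ k ∣ ℕ.≤ ∣ i ℤ.- j ∣ ℕ.+ ∣ j ∣) (cancel i j) (ℤ.∣i+j∣≤∣i∣+∣j∣ (i ℤ.- j) j)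
  where cancel : ∀ i j → (i ℤ.- j) ℤ.+ j ≡ i
        cancel = solve-∀

n+m<∣i∣⇒n<∣i-j∣ : ∀ {n m} i j → ∣ j ∣ ℕ.≤ m → n ℕ.+ m ℕ.< ∣ i ∣ → n ℕ.< ∣ i ℤ.- j ∣
n+m<∣i∣⇒n<∣i-j∣ {n} {m} i j ∣j∣≤m n+m<∣i∣ = ℕ.+-cancelʳ-< m n _ (begin-strict
  n ℕ.+ m                 <⟨ n+m<∣i∣ ⟩
  ∣ i ∣                   ≤⟨ ∣i∣≤∣i-j∣+∣j∣ i j ⟩
  ∣ i ℤ.- j ∣ ℕ.+ ∣ j ∣   ≤⟨ ℕ.+-monoʳ-≤ _ ∣j∣≤m ⟩
  ∣ i ℤ.- j ∣ ℕ.+ m       ∎)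
  where open ℕ.≤-Reasoning

-- Lines and directions

lineIndex-− : ∀ t x y u w → lineIndex t (x ℤ.- u) (y ℤ.- w) ≡ lineIndex t x y ℤ.- lineIndex t u w
lineIndex-− (intS k) x y u w = linear k x y u w
  where linear : ∀ k x y u w → k ℤ.* (x ℤ.- u) ℤ.- (y ℤ.- w) ≡ (k ℤ.* x ℤ.- y) ℤ.- (k ℤ.* u ℤ.- w)
        linear = solve-∀
lineIndex-− (invS k) x y u w = linear k x y u w
  where linear : ∀ k x y u w → (x ℤ.- u) ℤ.- k ℤ.* (y ℤ.- w) ≡ (x ℤ.- k ℤ.* y) ℤ.- (u ℤ.- k ℤ.* w)
        linear = solve-∀

coefficient : Slope → ℤ
coefficient (intS k) = k
coefficient (invS k) = k

∣lineIndex∣≤ : ∀ t {x y S} → ∣ x ∣ ℕ.≤ S → ∣ y ∣ ℕ.≤ S →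
               ∣ lineIndex t x y ∣ ℕ.≤ ∣ coefficient t ∣ ℕ.* S ℕ.+ S
∣lineIndex∣≤ (intS k) {x} {y} {S} ∣x∣≤S ∣y∣≤S = begin
  ∣ k ℤ.* x ℤ.- y ∣           ≤⟨ ℤ.∣i-j∣≤∣i∣+∣j∣ (k ℤ.* x) y ⟩
  ∣ k ℤ.* x ∣ ℕ.+ ∣ y ∣       ≡⟨ ≡.cong (ℕ._+ ∣ y ∣) (ℤ.abs-* k x) ⟩
  ∣ k ∣ ℕ.* ∣ x ∣ ℕ.+ ∣ y ∣   ≤⟨ ℕ.+-mono-≤ (ℕ.*-monoʳ-≤ ∣ k ∣ ∣x∣≤S) ∣y∣≤S ⟩
  ∣ k ∣ ℕ.* S ℕ.+ S           ∎
  where open ℕ.≤-Reasoning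
∣lineIndex∣≤ (invS k) {x} {y} {S} ∣x∣≤S ∣y∣≤S = begin
  ∣ x ℤ.- k ℤ.* y ∣           ≤⟨ ℤ.∣i-j∣≤∣i∣+∣j∣ x (k ℤ.* y) ⟩
  ∣ x ∣ ℕ.+ ∣ k ℤ.* y ∣       ≡⟨ ≡.cong (∣ x ∣ ℕ.+_) (ℤ.abs-* k y) ⟩
  ∣ x ∣ ℕ.+ ∣ k ∣ ℕ.* ∣ y ∣   ≤⟨ ℕ.+-mono-≤ ∣x∣≤S (ℕ.*-monoʳ-≤ ∣ k ∣ ∣y∣≤S) ⟩
  S ℕ.+ ∣ k ∣ ℕ.* S           ≡⟨ ℕ.+-comm S _ ⟩
  ∣ k ∣ ℕ.* S ℕ.+ S           ∎
  where open ℕ.≤-Reasoning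

-- A slope with a step (a, b) along its lines that is minimal in the x-direction.
record Direction : Set where
  field
    slope     : Slope
    a         : ℕ
    b         : ℤ
    1≤a       : 1 ℕ.≤ a
    along     : lineIndex slope (+ a) b ≡ 0ℤ
    separated : ∀ {x₁ y₁ x₂ y₂} → lineIndex slope x₁ y₁ ≡ lineIndex slope x₂ y₂ →
                ∣ x₁ ℤ.- x₂ ∣ ℕ.< a → x₁ ≡ x₂ × y₁ ≡ y₂

open Direction

Transversal : Direction → Slope → Set
Transversal d t = lineIndex t (+ a d) (b d) ≢ 0ℤ

Fits : ℕ → Direction → Set
Fits M d = a d ℕ.≤ M × ∣ b d ∣ ℕ.≤ M

strip-close : ∀ {c a x₁ x₂} → c ℤ.< x₁ → x₁ ℤ.≤ c ℤ.+ + a → c ℤ.< x₂ → x₂ ℤ.≤ c ℤ.+ + a →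
              ∣ x₁ ℤ.- x₂ ∣ ℕ.< a
strip-close {c} {a} {x₁} {x₂} c<x₁ x₁≤c+a c<x₂ x₂≤c+a =
  ∣i∣<n (gap x₁≤c+a c<x₂) (≡.subst (ℤ._< + a) (≡.sym (neg-− x₁ x₂)) (gap x₂≤c+a c<x₁))
  where
  ∣i∣<n : ∀ {i n} → i ℤ.< + n → ℤ.- i ℤ.< + n → ∣ i ∣ ℕ.< n
  ∣i∣<n {+ _}      (ℤ.+<+ m<n) _           = m<n
  ∣i∣<n { -[1+ _ ]} _          (ℤ.+<+ m<n) = m<n
  cancel : ∀ c a → (c ℤ.+ a) ℤ.- c ≡ a
  cancel = solve-∀
  gap : ∀ {x y} → x ℤ.≤ c ℤ.+ + a → c ℤ.< y → x ℤ.- y ℤ.< + a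
  gap x≤c+a c<y = ≡.subst (_ ℤ.<_) (cancel c (+ a)) (ℤ.+-mono-≤-< x≤c+a (ℤ.neg-mono-< c<y))

module _ {c ℓ} (S : Setoid c ℓ) where
  open Setoid S

  periodic-vanishing : ∀ (φ : ℤ → Carrier) {δ z} → δ ≢ 0ℤ → (∀ v → φ v ≈ φ (v ℤ.- δ)) →
                       ∀ B → (∀ v → B ℕ.< ∣ v ∣ → φ v ≈ z) → ∀ v → φ v ≈ z
  periodic-vanishing φ {δ} δ≢0 periodic B far v = trans (iterate N) (far _ B<∣v-Nδ∣)
    where
    iterate : ∀ N → φ v ≈ φ (v ℤ.- + N ℤ.* δ)
    iterate zero    = reflexive (≡.cong φ (step₀ v δ))
      where step₀ : ∀ v δ → v ≡ v ℤ.- ℤ.0ℤ ℤ.* δ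
            step₀ = solve-∀
    iterate (suc N) = trans (iterate N) (trans (periodic _) (reflexive (≡.cong φ (step (+ N) v δ))))
      where step : ∀ n v δ → (v ℤ.- n ℤ.* δ) ℤ.- δ ≡ v ℤ.- (ℤ.1ℤ ℤ.+ n) ℤ.* δ
            step = solve-∀
    N = suc (B ℕ.+ ∣ v ∣)
    B<∣v-Nδ∣ : B ℕ.< ∣ v ℤ.- + N ℤ.* δ ∣
    B<∣v-Nδ∣ = ℕ.+-cancelʳ-≤ ∣ v ∣ _ _ (begin
      N                                   ≤⟨ ℕ.m≤m*n N ∣ δ ∣ ⦃ ℕ.>-nonZero (ℕ.n≢0⇒n>0 (δ≢0 ∘ ℤ.∣i∣≡0⇒i≡0)) ⦄ ⟩
      N ℕ.* ∣ δ ∣                         ≡⟨ ℤ.abs-* (+ N) δ ⟨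
      ∣ + N ℤ.* δ ∣                       ≡⟨ ≡.cong ∣_∣ (cancel v (+ N ℤ.* δ)) ⟩
      ∣ v ℤ.- (v ℤ.- + N ℤ.* δ) ∣         ≤⟨ ℤ.∣i-j∣≤∣i∣+∣j∣ v _ ⟩
      ∣ v ∣ ℕ.+ ∣ v ℤ.- + N ℤ.* δ ∣       ≡⟨ ℕ.+-comm ∣ v ∣ _ ⟩
      ∣ v ℤ.- + N ℤ.* δ ∣ ℕ.+ ∣ v ∣       ∎)
      where
      open ℕ.≤-Reasoning
      cancel : ∀ v w → w ≡ v ℤ.- (v ℤ.- w)
      cancel = solve-∀

-- Line sums of finitely supported functions ℤ² → A

module LineSums {c ℓ} (A : AbelianGroup c ℓ) where

  open AbelianGroup A public
    renaming ( _∙_ to infixl 6 _+_; ε to 0#; _⁻¹ to infix 8 -_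
             ; ∙-cong to +-cong; ∙-congˡ to +-congˡ; ∙-congʳ to +-congʳ
             ; ⁻¹-cong to -‿cong; identityˡ to +-identityˡ; identityʳ to +-identityʳ
             ; assoc to +-assoc; inverseʳ to -‿inverseʳ )
    using (Carrier; _≈_; _-_; setoid; refl; sym; trans; reflexive)
  open import Algebra.Properties.AbelianGroup A using (ε⁻¹≈ε; ⁻¹-∙-comm; x≈y⇒x∙y⁻¹≈ε; x∙y⁻¹≈ε⇒x≈y)
  open import Algebra.Properties.CommutativeSemigroup (AbelianGroup.commutativeSemigroup A) using (interchange)
  open import Relation.Binary.Reasoning.Setoid setoid

  -‿vanishes : ∀ {x y} → x ≈ 0# → y ≈ 0# → x - y ≈ 0#
  -‿vanishes x≈0 y≈0 = trans (+-cong x≈0 (-‿cong y≈0)) (x≈y⇒x∙y⁻¹≈ε refl)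

  Σ< : ℕ → (ℕ → Carrier) → Carrier
  Σ< zero    h = 0#
  Σ< (suc L) h = h 0 + Σ< L (h ∘ suc)

  Σ<-cong : ∀ L {h h′} → (∀ k → k ℕ.< L → h k ≈ h′ k) → Σ< L h ≈ Σ< L h′
  Σ<-cong zero    eq = refl
  Σ<-cong (suc L) eq = +-cong (eq 0 (s≤s z≤n)) (Σ<-cong L (λ k k<L → eq (suc k) (s≤s k<L)))

  Σ<-zero : ∀ L {h} → (∀ k → k ℕ.< L → h k ≈ 0#) → Σ< L h ≈ 0#
  Σ<-zero zero    eq = refl
  Σ<-zero (suc L) eq =
    trans (+-cong (eq 0 (s≤s z≤n)) (Σ<-zero L (λ k k<L → eq (suc k) (s≤s k<L)))) (+-identityˡ 0#)

  Σ<-+ : ∀ L h h′ → Σ< L (λ k → h k + h′ k) ≈ Σ< L h + Σ< L h′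
  Σ<-+ zero    h h′ = sym (+-identityˡ 0#)
  Σ<-+ (suc L) h h′ = trans (+-congˡ (Σ<-+ L _ _)) (interchange _ _ _ _)

  Σ<-neg : ∀ L h → Σ< L (λ k → - h k) ≈ - Σ< L h
  Σ<-neg zero    h = sym ε⁻¹≈ε
  Σ<-neg (suc L) h = trans (+-congˡ (Σ<-neg L _)) (⁻¹-∙-comm _ _)

  Σ<-− : ∀ L h h′ → Σ< L (λ k → h k - h′ k) ≈ Σ< L h - Σ< L h′
  Σ<-− L h h′ = trans (Σ<-+ L h (λ k → - h′ k)) (+-congˡ (Σ<-neg L h′))

  Σ<-split : ∀ L₁ L₂ h → Σ< (L₁ ℕ.+ L₂) h ≈ Σ< L₁ h + Σ< L₂ (λ k → h (L₁ ℕ.+ k))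
  Σ<-split zero     L₂ h = sym (+-identityˡ _)
  Σ<-split (suc L₁) L₂ h = trans (+-congˡ (Σ<-split L₁ L₂ _)) (sym (+-assoc _ _ _))

  Σ<-last : ∀ L h → Σ< (suc L) h ≈ Σ< L h + h L
  Σ<-last L h = begin
    Σ< (suc L) h        ≡⟨ ≡.cong (λ L′ → Σ< L′ h) (ℕ.+-comm 1 L) ⟩
    Σ< (L ℕ.+ 1) h      ≈⟨ Σ<-split L 1 h ⟩
    Σ< L h + (h (L ℕ.+ 0) + 0#) ≈⟨ +-congˡ (trans (+-identityʳ _) (reflexive (≡.cong h (ℕ.+-identityʳ L)))) ⟩
    Σ< L h + h L        ∎

  Σ<-single : ∀ L {h} k₀ → k₀ ℕ.< L → (∀ k → k ℕ.< L → k ≢ k₀ → h k ≈ 0#) → Σ< L h ≈ h k₀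
  Σ<-single (suc L) zero _ eq =
    trans (+-congˡ (Σ<-zero L (λ k k<L → eq (suc k) (s≤s k<L) λ ()))) (+-identityʳ _)
  Σ<-single (suc L) (suc k₀) (s≤s k₀<L) eq =
    trans (+-congʳ (eq 0 (s≤s z≤n) λ ()))
      (trans (+-identityˡ _)
        (Σ<-single L k₀ k₀<L (λ k k<L k≢k₀ → eq (suc k) (s≤s k<L) (k≢k₀ ∘ ℕ.suc-injective))))

  Σ⟦_,_⟧_ : ℤ → ℕ → (ℤ → Carrier) → Carrier
  Σ⟦ lo , L ⟧ h = Σ< L (λ k → h (lo ℤ.+ + k))

  VanishesOutside : ℤ → ℕ → (ℤ → Carrier) → Set _
  VanishesOutside lo L h = ∀ x → x ℤ.< lo ⊎ lo ℤ.+ + L ℤ.≤ x → h x ≈ 0#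

  Σ⟦⟧-dropˡ : ∀ lo p L {h} → (∀ k → k ℕ.< p → h (lo ℤ.+ + k) ≈ 0#) →
              Σ⟦ lo , p ℕ.+ L ⟧ h ≈ Σ⟦ lo ℤ.+ + p , L ⟧ h
  Σ⟦⟧-dropˡ lo p L {h} zero-below = begin
    Σ⟦ lo , p ℕ.+ L ⟧ h                                     ≈⟨ Σ<-split p L _ ⟩
    Σ< p (λ k → h (lo ℤ.+ + k)) + Σ< L (λ k → h (lo ℤ.+ + (p ℕ.+ k)))
      ≈⟨ +-cong (Σ<-zero p zero-below) (Σ<-cong L λ k _ → reflexive (≡.cong h (+-+-assoc lo p k))) ⟩
    0# + Σ⟦ lo ℤ.+ + p , L ⟧ h                              ≈⟨ +-identityˡ _ ⟩
    Σ⟦ lo ℤ.+ + p , L ⟧ h                                   ∎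

  Σ⟦⟧-dropʳ : ∀ lo L r {h} → (∀ k → h (lo ℤ.+ + (L ℕ.+ k)) ≈ 0#) →
              Σ⟦ lo , L ℕ.+ r ⟧ h ≈ Σ⟦ lo , L ⟧ h
  Σ⟦⟧-dropʳ lo L r zero-above =
    trans (Σ<-split L r _) (trans (+-congˡ (Σ<-zero r λ k _ → zero-above k)) (+-identityʳ _))

  Σ⟦⟧-extend : ∀ {lo₁ L₁ lo₂ L₂ h} → lo₂ ℤ.≤ lo₁ → lo₁ ℤ.+ + L₁ ℤ.≤ lo₂ ℤ.+ + L₂ →
               VanishesOutside lo₁ L₁ h → Σ⟦ lo₂ , L₂ ⟧ h ≈ Σ⟦ lo₁ , L₁ ⟧ h
  Σ⟦⟧-extend {lo₁} {L₁} {lo₂} {L₂} {h} lo₂≤lo₁ hi₁≤hi₂ vanishes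
    with p , lo₂+p≡lo₁ ← i≤j⇒∃[k]i+k≡j lo₂≤lo₁
       | r , hi₁+r≡hi₂ ← i≤j⇒∃[k]i+k≡j hi₁≤hi₂ = begin
    Σ⟦ lo₂ , L₂ ⟧ h                  ≡⟨ ≡.cong (λ L → Σ⟦ lo₂ , L ⟧ h) L₂≡p+L₁+r ⟩
    Σ⟦ lo₂ , p ℕ.+ (L₁ ℕ.+ r) ⟧ h    ≈⟨ Σ⟦⟧-dropˡ lo₂ p (L₁ ℕ.+ r) {h} below ⟩
    Σ⟦ lo₂ ℤ.+ + p , L₁ ℕ.+ r ⟧ h    ≡⟨ ≡.cong (λ lo → Σ⟦ lo , L₁ ℕ.+ r ⟧ h) lo₂+p≡lo₁ ⟩
    Σ⟦ lo₁ , L₁ ℕ.+ r ⟧ h            ≈⟨ Σ⟦⟧-dropʳ lo₁ L₁ r {h} above ⟩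
    Σ⟦ lo₁ , L₁ ⟧ h                  ∎
    where
    L₂≡p+L₁+r : L₂ ≡ p ℕ.+ (L₁ ℕ.+ r)
    L₂≡p+L₁+r = length-from-offsets lo₂ p L₁ r L₂
                  (≡.subst (λ lo → (lo ℤ.+ + L₁) ℤ.+ + r ≡ _) (≡.sym lo₂+p≡lo₁) hi₁+r≡hi₂)
    below : ∀ k → k ℕ.< p → h (lo₂ ℤ.+ + k) ≈ 0#
    below k k<p = vanishes _ (inj₁ (≡.subst (lo₂ ℤ.+ + k ℤ.<_) lo₂+p≡lo₁ (ℤ.+-monoʳ-< lo₂ (ℤ.+<+ k<p))))
    above : ∀ k → h (lo₁ ℤ.+ + (L₁ ℕ.+ k)) ≈ 0#
    above k = vanishes _ (inj₂ (≡.subst (lo₁ ℤ.+ + L₁ ℤ.≤_) (≡.sym (+-+-assoc lo₁ L₁ k)) (ℤ.i≤i+j _ (+ k))))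

  VanishesOutside-shift : ∀ {lo L h} s → VanishesOutside lo L h →
                          VanishesOutside (lo ℤ.+ s) L (λ x → h (x ℤ.- s))
  VanishesOutside-shift {lo} {L} s vanishes x (inj₁ x<lo+s) =
    vanishes _ (inj₁ (≡.subst (x ℤ.- s ℤ.<_) (cancel lo s) (ℤ.+-monoˡ-< (ℤ.- s) x<lo+s)))
    where cancel : ∀ i j → (i ℤ.+ j) ℤ.- j ≡ i
          cancel = solve-∀
  VanishesOutside-shift {lo} {L} s vanishes x (inj₂ hi+s≤x) =
    vanishes _ (inj₂ (≡.subst (ℤ._≤ x ℤ.- s) (cancel lo s (+ L)) (ℤ.+-monoˡ-≤ (ℤ.- s) hi+s≤x)))
    where cancel : ∀ i j l → ((i ℤ.+ j) ℤ.+ l) ℤ.- j ≡ i ℤ.+ l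
          cancel = solve-∀

  Σ⟦⟧-shift : ∀ lo L s h → Σ⟦ lo ℤ.+ s , L ⟧ (λ x → h (x ℤ.- s)) ≈ Σ⟦ lo , L ⟧ h
  Σ⟦⟧-shift lo L s h = Σ<-cong L (λ k _ → reflexive (≡.cong h (cancel lo s (+ k))))
    where cancel : ∀ i j k → ((i ℤ.+ j) ℤ.+ k) ℤ.- j ≡ i ℤ.+ k
          cancel = solve-∀

  VanishesBeyond : ℕ → (ℤ → Carrier) → Set _
  VanishesBeyond S h = ∀ x → S ℕ.< ∣ x ∣ → h x ≈ 0#

  VanishesBeyond⇒VanishesOutside : ∀ {S h} → VanishesBeyond S h →
                                   VanishesOutside (ℤ.- + S) (suc (S ℕ.+ S)) h
  VanishesBeyond⇒VanishesOutside {S} vanishes x (inj₁ x<-S) = vanishes x (i<-n⇒n<∣i∣ x<-S)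
  VanishesBeyond⇒VanishesOutside {S} vanishes x (inj₂ S+1≤x) =
    vanishes x (n<i⇒n<∣i∣ (ℤ.suc[i]≤j⇒i<j (≡.subst (ℤ._≤ x) (top (+ S)) S+1≤x)))
    where top : ∀ S → ℤ.- S ℤ.+ (ℤ.1ℤ ℤ.+ (S ℤ.+ S)) ≡ ℤ.1ℤ ℤ.+ S
          top = solve-∀

  Σ± : ℕ → (ℤ → Carrier) → Carrier
  Σ± R h = Σ⟦ ℤ.- + R , suc (R ℕ.+ R) ⟧ h

  Σ±-window : ∀ {S R} s {h} → VanishesBeyond S h → S ℕ.+ ∣ s ∣ ℕ.≤ R →
              Σ± R (λ x → h (x ℤ.- s)) ≈ Σ⟦ ℤ.- + S , suc (S ℕ.+ S) ⟧ h
  Σ±-window {S} s {h} vanishes fits =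
    trans (Σ⟦⟧-extend (proj₁ (window⊆box s fits)) (proj₂ (window⊆box s fits))
                      (VanishesOutside-shift s (VanishesBeyond⇒VanishesOutside vanishes)))
          (Σ⟦⟧-shift (ℤ.- + S) (suc (S ℕ.+ S)) s h)

  Σ±-translate : ∀ {S R} s {h} → VanishesBeyond S h → S ℕ.+ ∣ s ∣ ℕ.≤ R →
                 Σ± R (λ x → h (x ℤ.- s)) ≈ Σ± R h
  Σ±-translate {S} {R} s {h} vanishes fits = trans (Σ±-window s vanishes fits) (sym (begin
    Σ± R h                     ≈⟨ Σ<-cong (suc (R ℕ.+ R))
                                    (λ k _ → reflexive (≡.cong h (ℤ.+-identityʳ (ℤ.- + R ℤ.+ + k)))) ⟨
    Σ± R (λ x → h (x ℤ.- 0ℤ))  ≈⟨ Σ±-window 0ℤ vanishes S+0≤R ⟩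
    Σ⟦ ℤ.- + S , suc (S ℕ.+ S) ⟧ h ∎))
    where
    S+0≤R : S ℕ.+ ∣ 0ℤ ∣ ℕ.≤ R
    S+0≤R = ℕ.≤-trans (ℕ.≤-reflexive (ℕ.+-identityʳ S)) (ℕ.≤-trans (ℕ.m≤m+n S ∣ s ∣) fits)

  Σ⟦⟧-single : ∀ lo L {h} k₀ → k₀ ℕ.< L → (∀ u → u ≢ lo ℤ.+ + k₀ → h u ≈ 0#) →
               Σ⟦ lo , L ⟧ h ≈ h (lo ℤ.+ + k₀)
  Σ⟦⟧-single lo L k₀ k₀<L vanishes =
    Σ<-single L k₀ k₀<L (λ k _ k≢k₀ → vanishes _ (k≢k₀ ∘ ℤ.+-injective ∘ +-cancelˡ lo _ _))

  Σ±-single : ∀ R {h} x → ∣ x ∣ ℕ.≤ R → (∀ u → u ≢ x → h u ≈ 0#) → Σ± R h ≈ h x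
  Σ±-single R {h} x ∣x∣≤R vanishes
    with k , -R+k≡x ← i≤j⇒∃[k]i+k≡j (∣i∣≤n⇒-n≤i ∣x∣≤R) = begin
    Σ± R h              ≈⟨ Σ⟦⟧-single (ℤ.- + R) _ k (s≤s (ℤ.drop‿+≤+ k≤R+R)) vanishes′ ⟩
    h (ℤ.- + R ℤ.+ + k) ≡⟨ ≡.cong h -R+k≡x ⟩
    h x                 ∎
    where
    vanishes′ : ∀ u → u ≢ ℤ.- + R ℤ.+ + k → h u ≈ 0#
    vanishes′ u u≢ = vanishes u (λ u≡x → u≢ (≡.trans u≡x (≡.sym -R+k≡x)))
    uncancel : ∀ r k → k ≡ (ℤ.- r ℤ.+ k) ℤ.+ r
    uncancel = solve-∀
    k≤R+R : + k ℤ.≤ + (R ℕ.+ R)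
    k≤R+R = ≡.subst (ℤ._≤ _) (≡.trans (≡.cong (ℤ._+ + R) (≡.sym -R+k≡x)) (≡.sym (uncancel (+ R) (+ k))))
                    (ℤ.+-monoˡ-≤ (+ R) (∣i∣≤n⇒i≤n {x} ∣x∣≤R))

  when : Bool → Carrier → Carrier
  when b x = if b then x else 0#

  when-cong : ∀ b {x y} → x ≈ y → when b x ≈ when b y
  when-cong true  x≈y = x≈y
  when-cong false _   = refl

  when-vanishes : ∀ b {x} → x ≈ 0# → when b x ≈ 0#
  when-vanishes true  x≈0 = x≈0
  when-vanishes false _   = refl

  when-− : ∀ b x y → when b (x - y) ≈ when b x - when b y
  when-− true  x y = refl
  when-− false x y = sym (x≈y⇒x∙y⁻¹≈ε refl)

  when-true : ∀ {p} {P : Set p} (P? : Dec P) → P → ∀ x → when ⌊ P? ⌋ x ≡ x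
  when-true (yes _) _  x = ≡.refl
  when-true (no ¬p) p x = ⊥-elim (¬p p)

  when-false : ∀ {p} {P : Set p} (P? : Dec P) → ¬ P → ∀ x → when ⌊ P? ⌋ x ≡ 0#
  when-false (yes p) ¬p x = ⊥-elim (¬p p)
  when-false (no _)  _  x = ≡.refl

  when-⌊⌋ : ∀ {p q} {P : Set p} {Q : Set q} (P? : Dec P) (Q? : Dec Q) → (P → Q) → (Q → P) →
            ∀ x → when ⌊ P? ⌋ x ≡ when ⌊ Q? ⌋ x
  when-⌊⌋ (yes _) (yes _) _   _   x = ≡.refl
  when-⌊⌋ (no _)  (no _)  _   _   x = ≡.refl
  when-⌊⌋ (yes p) (no ¬q) p⇒q _   x = ⊥-elim (¬q (p⇒q p))
  when-⌊⌋ (no ¬p) (yes q) _   q⇒p x = ⊥-elim (¬p (q⇒p q))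

  padℕ : ∀ {n} → (Fin n → Carrier) → ℕ → Carrier
  padℕ {zero}  g k       = 0#
  padℕ {suc n} g zero    = g Fin.zero
  padℕ {suc n} g (suc k) = padℕ (g ∘ Fin.suc) k

  padℕ-toℕ : ∀ {n} (g : Fin n → Carrier) i → padℕ g (toℕ i) ≡ g i
  padℕ-toℕ g Fin.zero    = ≡.refl
  padℕ-toℕ g (Fin.suc i) = padℕ-toℕ (g ∘ Fin.suc) i

  padℕ-beyond : ∀ {n} (g : Fin n → Carrier) k → n ℕ.≤ k → padℕ g k ≡ 0#
  padℕ-beyond {zero}  g k       _         = ≡.refl
  padℕ-beyond {suc n} g (suc k) (s≤s n≤k) = padℕ-beyond (g ∘ Fin.suc) k n≤k

  padℕ-vanishes : ∀ {n} (g : Fin n → Carrier) → (∀ i → g i ≈ 0#) → ∀ k → padℕ g k ≈ 0#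
  padℕ-vanishes {zero}  g _  k       = refl
  padℕ-vanishes {suc n} g g≈0 zero    = g≈0 Fin.zero
  padℕ-vanishes {suc n} g g≈0 (suc k) = padℕ-vanishes (g ∘ Fin.suc) (g≈0 ∘ Fin.suc) k

  -- Extension by zero of a function on the grid columns, placed at the coordinates `coord i`.
  pad : ∀ {n} → (Fin n → Carrier) → ℤ → Carrier
  pad g (+ suc k)  = padℕ g k
  pad g (+ zero)   = 0#
  pad g -[1+ _ ]   = 0#

  pad-vanishes : ∀ {n} (g : Fin n → Carrier) → (∀ i → g i ≈ 0#) → ∀ x → pad g x ≈ 0#
  pad-vanishes g g≈0 (+ suc k) = padℕ-vanishes g g≈0 k
  pad-vanishes g g≈0 (+ zero)  = refl
  pad-vanishes g g≈0 -[1+ _ ]  = refl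

  pad-outside : ∀ {n} (g : Fin n → Carrier) x → x ℤ.≤ 0ℤ ⊎ + n ℤ.< x → pad g x ≈ 0#
  pad-outside g (+ zero)   _                      = refl
  pad-outside g -[1+ _ ]   _                      = refl
  pad-outside g (+ suc k)  (inj₁ (ℤ.+≤+ ()))
  pad-outside g (+ suc k)  (inj₂ (ℤ.+<+ n<1+k)) = reflexive (padℕ-beyond g k (ℕ.≤-pred n<1+k))

  pad² : ∀ {n} → (Fin n → Fin n → Carrier) → ℤ → ℤ → Carrier
  pad² X x y = pad (λ i → pad (X i) y) x

  pad²-coord : ∀ {n} (X : Fin n → Fin n → Carrier) i j → pad² X (coord i) (coord j) ≡ X i j
  pad²-coord X i j = ≡.trans (padℕ-toℕ _ i) (padℕ-toℕ (X i) j)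

  module Box (R : ℕ) where

    Σ² : (ℤ → ℤ → Carrier) → Carrier
    Σ² F = Σ± R (λ x → Σ± R (F x))

    BoundedBy : ℕ → (ℤ → ℤ → Carrier) → Set _
    BoundedBy S F = ∀ x y → S ℕ.< ∣ x ∣ ⊎ S ℕ.< ∣ y ∣ → F x y ≈ 0#

    Σ±-cong : ∀ {h h′} → (∀ x → h x ≈ h′ x) → Σ± R h ≈ Σ± R h′
    Σ±-cong eq = Σ<-cong (suc (R ℕ.+ R)) (λ k _ → eq (ℤ.- + R ℤ.+ + k))

    Σ±-zero : ∀ {h} → (∀ x → h x ≈ 0#) → Σ± R h ≈ 0#
    Σ±-zero eq = Σ<-zero (suc (R ℕ.+ R)) (λ k _ → eq (ℤ.- + R ℤ.+ + k))

    Σ±-− : ∀ h h′ → Σ± R (λ x → h x - h′ x) ≈ Σ± R h - Σ± R h′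
    Σ±-− h h′ = Σ<-− (suc (R ℕ.+ R)) (λ k → h (ℤ.- + R ℤ.+ + k)) (λ k → h′ (ℤ.- + R ℤ.+ + k))

    Σ²-cong : ∀ {F G} → (∀ x y → F x y ≈ G x y) → Σ² F ≈ Σ² G
    Σ²-cong eq = Σ±-cong (λ x → Σ±-cong (eq x))

    Σ²-zero : ∀ {F} → (∀ x y → F x y ≈ 0#) → Σ² F ≈ 0#
    Σ²-zero eq = Σ±-zero (λ x → Σ±-zero (eq x))

    Σ²-− : ∀ F G → Σ² (λ x y → F x y - G x y) ≈ Σ² F - Σ² G
    Σ²-− F G = trans (Σ±-cong (λ x → Σ±-− (F x) (G x))) (Σ±-− (λ x → Σ± R (F x)) (λ x → Σ± R (G x)))

    Σ²-translate : ∀ {S F} s t → BoundedBy S F → S ℕ.+ ∣ s ∣ ℕ.≤ R → S ℕ.+ ∣ t ∣ ℕ.≤ R →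
                   Σ² (λ x y → F (x ℤ.- s) (y ℤ.- t)) ≈ Σ² F
    Σ²-translate {F = F} s t bounded fits-s fits-t =
      trans (Σ±-cong (λ x → Σ±-translate t {F (x ℤ.- s)} (λ y S<∣y∣ → bounded (x ℤ.- s) y (inj₂ S<∣y∣)) fits-t))
            (Σ±-translate s (λ x S<∣x∣ → Σ±-zero (λ y → bounded x y (inj₁ S<∣x∣))) fits-s)

    Σ²-single : ∀ {F} x y → ∣ x ∣ ℕ.≤ R → ∣ y ∣ ℕ.≤ R →
                (∀ u w → u ≢ x ⊎ w ≢ y → F u w ≈ 0#) → Σ² F ≈ F x y
    Σ²-single x y ∣x∣≤R ∣y∣≤R vanishes =
      trans (Σ±-single R x ∣x∣≤R (λ u u≢x → Σ±-zero (λ w → vanishes u w (inj₁ u≢x))))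
            (Σ±-single R y ∣y∣≤R (λ w w≢y → vanishes x w (inj₂ w≢y)))

    Σline : Slope → (ℤ → ℤ → Carrier) → ℤ → Carrier
    Σline t F v = Σ² (λ x y → when ⌊ lineIndex t x y ℤ.≟ v ⌋ (F x y))

    Σline-cong : ∀ t {F G} → (∀ x y → F x y ≈ G x y) → ∀ v → Σline t F v ≈ Σline t G v
    Σline-cong t eq v = Σ²-cong (λ x y → when-cong ⌊ lineIndex t x y ℤ.≟ v ⌋ (eq x y))

    Σline-− : ∀ t F G v → Σline t (λ x y → F x y - G x y) v ≈ Σline t F v - Σline t G v
    Σline-− t F G v = trans (Σ²-cong (λ x y → when-− (on x y) (F x y) (G x y)))
                            (Σ²-− (λ x y → when (on x y) (F x y)) (λ x y → when (on x y) (G x y)))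
      where on = λ x y → ⌊ lineIndex t x y ℤ.≟ v ⌋

    Σline-translate : ∀ t {S F} s u → BoundedBy S F → S ℕ.+ ∣ s ∣ ℕ.≤ R → S ℕ.+ ∣ u ∣ ℕ.≤ R →
                      ∀ v → Σline t (λ x y → F (x ℤ.- s) (y ℤ.- u)) v ≈ Σline t F (v ℤ.- lineIndex t s u)
    Σline-translate t {F = F} s u bounded fits-s fits-u v = begin
      Σline t (λ x y → F (x ℤ.- s) (y ℤ.- u)) v
        ≈⟨ Σ²-cong (λ x y → reflexive (when-⌊⌋ (lineIndex t x y ℤ.≟ v) (_ ℤ.≟ v ℤ.- δ)
                                                (shift x y) (unshift x y) (F (x ℤ.- s) (y ℤ.- u)))) ⟩
      Σ² (λ x y → H (x ℤ.- s) (y ℤ.- u))        ≈⟨ Σ²-translate s u bounded-H fits-s fits-u ⟩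
      Σline t F (v ℤ.- δ)                        ∎
      where
      δ = lineIndex t s u
      H : ℤ → ℤ → Carrier
      H x y = when ⌊ lineIndex t x y ℤ.≟ v ℤ.- δ ⌋ (F x y)
      bounded-H : BoundedBy _ H
      bounded-H x y out = when-vanishes ⌊ lineIndex t x y ℤ.≟ v ℤ.- δ ⌋ (bounded x y out)
      shift : ∀ x y → lineIndex t x y ≡ v → lineIndex t (x ℤ.- s) (y ℤ.- u) ≡ v ℤ.- δ
      shift x y ℓ≡v = ≡.trans (lineIndex-− t x y s u) (≡.cong (ℤ._- δ) ℓ≡v)
      unshift : ∀ x y → lineIndex t (x ℤ.- s) (y ℤ.- u) ≡ v ℤ.- δ → lineIndex t x y ≡ v
      unshift x y eq = +-cancelʳ (ℤ.- δ) _ _ (≡.trans (≡.sym (lineIndex-− t x y s u)) eq)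

    Σline-far : ∀ t {S F} → BoundedBy S F → ∀ v → ∣ coefficient t ∣ ℕ.* S ℕ.+ S ℕ.< ∣ v ∣ →
                Σline t F v ≈ 0#
    Σline-far t {S} {F} bounded v far = Σ²-zero term
      where
      term : ∀ x y → when ⌊ lineIndex t x y ℤ.≟ v ⌋ (F x y) ≈ 0#
      term x y with lineIndex t x y ℤ.≟ v
      ... | no _ = refl
      ... | yes ℓ≡v with S ℕ.<? ∣ x ∣ | S ℕ.<? ∣ y ∣
      ...   | yes S<∣x∣ | _         = bounded x y (inj₁ S<∣x∣)
      ...   | no _      | yes S<∣y∣ = bounded x y (inj₂ S<∣y∣)
      ...   | no S≮∣x∣  | no S≮∣y∣  =
        ⊥-elim (ℕ.<⇒≱ far (≡.subst (λ w → ∣ w ∣ ℕ.≤ _) ℓ≡v (∣lineIndex∣≤ t (ℕ.≮⇒≥ S≮∣x∣) (ℕ.≮⇒≥ S≮∣y∣))))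

    strip-vanishing : ∀ d c {S r} → S ℕ.≤ R → BoundedBy S r →
                      (∀ x y → x ℤ.≤ c ⊎ c ℤ.+ + a d ℤ.< x → r x y ≈ 0#) →
                      (∀ v → Σline (slope d) r v ≈ 0#) → ∀ x y → r x y ≈ 0#
    strip-vanishing d c {S} {r} S≤R bounded off-strip zero-sums x y
      with x ℤ.≤? c | c ℤ.+ + a d ℤ.<? x | S ℕ.<? ∣ x ∣ | S ℕ.<? ∣ y ∣
    ... | yes x≤c | _       | _       | _       = off-strip x y (inj₁ x≤c)
    ... | no _    | yes c+a<x | _     | _       = off-strip x y (inj₂ c+a<x)
    ... | no _    | no _    | yes S<∣x∣ | _     = bounded x y (inj₁ S<∣x∣)
    ... | no _    | no _    | no _    | yes S<∣y∣ = bounded x y (inj₂ S<∣y∣)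
    ... | no x≰c  | no c+a≮x | no S≮∣x∣ | no S≮∣y∣ = begin
      r x y                            ≡⟨ when-true (line x y ℤ.≟ line x y) ≡.refl (r x y) ⟨
      when ⌊ line x y ℤ.≟ line x y ⌋ (r x y) ≈⟨ Σ²-single x y (within {x} S≮∣x∣) (within {y} S≮∣y∣) elsewhere ⟨
      Σline (slope d) r (line x y)        ≈⟨ zero-sums (line x y) ⟩
      0#                               ∎
      where
      line = lineIndex (slope d)
      within : ∀ {z} → S ℕ.≮ ∣ z ∣ → ∣ z ∣ ℕ.≤ R
      within S≮∣z∣ = ℕ.≤-trans (ℕ.≮⇒≥ S≮∣z∣) S≤R
      elsewhere : ∀ u w → u ≢ x ⊎ w ≢ y → when ⌊ line u w ℤ.≟ line x y ⌋ (r u w) ≈ 0#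
      elsewhere u w u,w≢x,y with line u w ℤ.≟ line x y
      ... | no _ = refl
      ... | yes same with u ℤ.≤? c | c ℤ.+ + a d ℤ.<? u
      ...   | yes u≤c | _         = off-strip u w (inj₁ u≤c)
      ...   | no _    | yes c+a<u = off-strip u w (inj₂ c+a<u)
      ...   | no u≰c  | no c+a≮u  with separated d same
                (strip-close (ℤ.≰⇒> u≰c) (ℤ.≮⇒≥ c+a≮u) (ℤ.≰⇒> x≰c) (ℤ.≮⇒≥ c+a≮x))
      ...     | u≡x , w≡y = ⊥-elim ([ (λ u≢x → u≢x u≡x) , (λ w≢y → w≢y w≡y) ] u,w≢x,y)

    BoundedBy-mono : ∀ {S S′ F} → S ℕ.≤ S′ → BoundedBy S F → BoundedBy S′ F
    BoundedBy-mono S≤S′ bounded x y (inj₁ S′<∣x∣) = bounded x y (inj₁ (ℕ.≤-<-trans S≤S′ S′<∣x∣))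
    BoundedBy-mono S≤S′ bounded x y (inj₂ S′<∣y∣) = bounded x y (inj₂ (ℕ.≤-<-trans S≤S′ S′<∣y∣))

    BoundedBy-− : ∀ {S F G} → BoundedBy S F → BoundedBy S G → BoundedBy S (λ x y → F x y - G x y)
    BoundedBy-− bounded-F bounded-G x y out = -‿vanishes (bounded-F x y out) (bounded-G x y out)

    BoundedBy-translate : ∀ {S M F} s u → ∣ s ∣ ℕ.≤ M → ∣ u ∣ ℕ.≤ M → BoundedBy S F →
                          BoundedBy (S ℕ.+ M) (λ x y → F (x ℤ.- s) (y ℤ.- u))
    BoundedBy-translate s u ∣s∣≤M ∣u∣≤M bounded x y (inj₁ far) = bounded _ _ (inj₁ (n+m<∣i∣⇒n<∣i-j∣ x s ∣s∣≤M far))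
    BoundedBy-translate s u ∣s∣≤M ∣u∣≤M bounded x y (inj₂ far) = bounded _ _ (inj₂ (n+m<∣i∣⇒n<∣i-j∣ y u ∣u∣≤M far))

    SupportedIn : ℤ → ℕ → (ℤ → ℤ → Carrier) → Set _
    SupportedIn W Y f = ∀ x y → x ℤ.≤ 0ℤ ⊎ W ℤ.< x ⊎ Y ℕ.< ∣ y ∣ → f x y ≈ 0#

    SupportedIn⇒BoundedBy : ∀ {W Y f} → W ℤ.≤ + Y → SupportedIn W Y f → BoundedBy Y f
    SupportedIn⇒BoundedBy W≤Y supported x       y (inj₂ Y<∣y∣) = supported x y (inj₂ (inj₂ Y<∣y∣))
    SupportedIn⇒BoundedBy W≤Y supported (+ _)   y (inj₁ Y<∣x∣) =
      supported _ y (inj₂ (inj₁ (ℤ.≤-<-trans W≤Y (ℤ.+<+ Y<∣x∣))))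
    SupportedIn⇒BoundedBy W≤Y supported -[1+ _ ] y (inj₁ _)    = supported _ y (inj₁ ℤ.-≤+)

    pad²-supported : ∀ {n} (X : Fin n → Fin n → Carrier) → SupportedIn (+ n) n (pad² X)
    pad²-supported X x y (inj₁ x≤0)          = pad-outside _ x (inj₁ x≤0)
    pad²-supported X x y (inj₂ (inj₁ n<x))   = pad-outside _ x (inj₂ n<x)
    pad²-supported X x y (inj₂ (inj₂ n<∣y∣)) = pad-vanishes _ (λ i → pad-outside (X i) y (n<∣i∣⇒i≤0⊎n<i n<∣y∣)) x

    module Peel (d : Direction) {M W Y f} (a≤M : a d ℕ.≤ M) (∣b∣≤M : ∣ b d ∣ ℕ.≤ M)
                (W≤Y : W ℤ.≤ + Y) (fits : Y ℕ.+ Y ℕ.* M ℕ.+ M ℕ.≤ R)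
                (supported : SupportedIn W Y f) (zero-sums : ∀ v → Σline (slope d) f v ≈ 0#) where

      cut : ℤ
      cut = W ℤ.- + a d

      Y′ : ℕ
      Y′ = Y ℕ.+ Y ℕ.* M

      trail : ℤ → ℤ → Carrier
      trail x y = Σ< Y (λ m → f (x ℤ.- + (m ℕ.* a d)) (y ℤ.- + m ℤ.* b d))

      G : ℤ → ℤ → Carrier
      G x y = when ⌊ x ℤ.≤? cut ⌋ (trail x y)

      τG : ℤ → ℤ → Carrier
      τG x y = G (x ℤ.- + a d) (y ℤ.- b d)

      cut≤W : cut ℤ.≤ W
      cut≤W = ℤ.i-j≤i W (+ a d)

      -- The Y-th term vanishes since x - Y a ≤ W - Y ≤ 0.
      trail-step : ∀ x y → x ℤ.≤ W → trail x y ≈ f x y + trail (x ℤ.- + a d) (y ℤ.- b d)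
      trail-step x y x≤W = begin
        trail x y                          ≈⟨ +-identityʳ _ ⟨
        trail x y + 0#                     ≈⟨ +-congˡ last-vanishes ⟨
        trail x y + T Y                    ≈⟨ Σ<-last Y T ⟨
        T 0 + Σ< Y (λ m → T (suc m))
          ≈⟨ +-cong (reflexive (≡.cong₂ f (ℤ.+-identityʳ x) (ℤ.+-identityʳ y)))
                    (Σ<-cong Y (λ m _ → reflexive (≡.cong₂ f (x-step m) (y-step (+ m) y (b d))))) ⟩
        f x y + trail (x ℤ.- + a d) (y ℤ.- b d) ∎
        where
        T : ℕ → Carrier
        T m = f (x ℤ.- + (m ℕ.* a d)) (y ℤ.- + m ℤ.* b d)
        Y≤Ya : + Y ℤ.≤ + (Y ℕ.* a d)
        Y≤Ya = ℤ.+≤+ (ℕ.≤-trans (ℕ.≤-reflexive (≡.sym (ℕ.*-identityʳ Y))) (ℕ.*-monoʳ-≤ Y (1≤a d)))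
        last-vanishes : T Y ≈ 0#
        last-vanishes = supported _ _ (inj₁ (ℤ.i≤j⇒i-j≤0 (ℤ.≤-trans x≤W (ℤ.≤-trans W≤Y Y≤Ya))))
        assoc : ∀ x a b → x ℤ.- (a ℤ.+ b) ≡ (x ℤ.- a) ℤ.- b
        assoc = solve-∀
        x-step : ∀ m → x ℤ.- + (suc m ℕ.* a d) ≡ (x ℤ.- + a d) ℤ.- + (m ℕ.* a d)
        x-step m = assoc x (+ a d) (+ (m ℕ.* a d))
        y-step : ∀ m y b → y ℤ.- (ℤ.1ℤ ℤ.+ m) ℤ.* b ≡ (y ℤ.- b) ℤ.- m ℤ.* b
        y-step = solve-∀

      G-supported : SupportedIn cut Y′ G
      G-supported x y (inj₁ x≤0) =
        when-vanishes ⌊ x ℤ.≤? cut ⌋ (Σ<-zero Y (λ m _ → supported _ _ (inj₁ (ℤ.≤-trans (ℤ.i-j≤i x _) x≤0))))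
      G-supported x y (inj₂ (inj₁ cut<x)) = reflexive (when-false (x ℤ.≤? cut) (ℤ.<⇒≱ cut<x) _)
      G-supported x y (inj₂ (inj₂ Y′<∣y∣)) =
        when-vanishes ⌊ x ℤ.≤? cut ⌋ (Σ<-zero Y (λ m m<Y → supported _ _ (inj₂ (inj₂
          (n+m<∣i∣⇒n<∣i-j∣ y (+ m ℤ.* b d) (∣mb∣≤YM m<Y) Y′<∣y∣)))))
        where
        ∣mb∣≤YM : ∀ {m} → m ℕ.< Y → ∣ + m ℤ.* b d ∣ ℕ.≤ Y ℕ.* M
        ∣mb∣≤YM {m} m<Y = ℕ.≤-trans (ℕ.≤-reflexive (ℤ.abs-* (+ m) (b d))) (ℕ.*-mono-≤ (ℕ.<⇒≤ m<Y) ∣b∣≤M)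

      f-bounded : BoundedBy Y f
      f-bounded = SupportedIn⇒BoundedBy W≤Y supported

      G-bounded : BoundedBy Y′ G
      G-bounded = SupportedIn⇒BoundedBy (ℤ.≤-trans cut≤W (ℤ.≤-trans W≤Y (ℤ.+≤+ (ℕ.m≤m+n Y _)))) G-supported

      τG-bounded : BoundedBy (Y′ ℕ.+ M) τG
      τG-bounded = BoundedBy-translate (+ a d) (b d) a≤M ∣b∣≤M G-bounded

      Σline-G-τG : ∀ t v → Σline t (λ x y → G x y - τG x y) v ≈
                           Σline t G v - Σline t G (v ℤ.- lineIndex t (+ a d) (b d))
      Σline-G-τG t v = trans (Σline-− t G τG v) (+-congˡ (-‿cong
        (Σline-translate t (+ a d) (b d) G-bounded (fits-Y′ a≤M) (fits-Y′ ∣b∣≤M) v)))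
        where
        fits-Y′ : ∀ {s} → s ℕ.≤ M → Y′ ℕ.+ s ℕ.≤ R
        fits-Y′ s≤M = ℕ.≤-trans (ℕ.+-monoʳ-≤ Y′ s≤M) fits

      residual : ℤ → ℤ → Carrier
      residual x y = f x y - (G x y - τG x y)

      residual-off-strip : ∀ x y → x ℤ.≤ cut ⊎ cut ℤ.+ + a d ℤ.< x → residual x y ≈ 0#
      residual-off-strip x y (inj₁ x≤cut) = begin
        f x y - (G x y - τG x y)                 ≡⟨ ≡.cong₂ (λ g g′ → f x y - (g - g′))
                                                       (when-true (x ℤ.≤? cut) x≤cut _)
                                                       (when-true (x′ ℤ.≤? cut) (ℤ.≤-trans (ℤ.i-j≤i x _) x≤cut) _) ⟩
        f x y - (trail x y - trail x′ y′)        ≈⟨ +-congˡ (-‿cong (+-congʳ (trail-step x y (ℤ.≤-trans x≤cut cut≤W)))) ⟩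
        f x y - ((f x y + trail x′ y′) - trail x′ y′) ≈⟨ +-congˡ (-‿cong (cancel (f x y) (trail x′ y′))) ⟩
        f x y - f x y                            ≈⟨ -‿inverseʳ (f x y) ⟩
        0#                                       ∎
        where
        x′ = x ℤ.- + a d
        y′ = y ℤ.- b d
        cancel : ∀ u w → (u + w) - w ≈ u
        cancel u w = trans (+-assoc u w (- w)) (trans (+-congˡ (-‿inverseʳ w)) (+-identityʳ u))
      residual-off-strip x y (inj₂ cut+a<x) =
        -‿vanishes (supported x y (inj₂ (inj₁ (≡.subst (ℤ._< x) (cancel W (+ a d)) cut+a<x))))
          (-‿vanishes (G-supported x y (inj₂ (inj₁ (ℤ.≤-<-trans (ℤ.i≤i+j cut (+ a d)) cut+a<x))))
                      (G-supported (x ℤ.- + a d) (y ℤ.- b d) (inj₂ (inj₁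
                        (≡.subst (ℤ._< _) (uncancel cut (+ a d)) (ℤ.+-monoˡ-< (ℤ.- + a d) cut+a<x))))))
        where
        cancel : ∀ w a → (w ℤ.- a) ℤ.+ a ≡ w
        cancel = solve-∀
        uncancel : ∀ c a → (c ℤ.+ a) ℤ.- a ≡ c
        uncancel = solve-∀

      residual-bounded : BoundedBy (Y′ ℕ.+ M) residual
      residual-bounded = BoundedBy-− (BoundedBy-mono (ℕ.≤-trans (ℕ.m≤m+n Y _) (ℕ.m≤m+n Y′ M)) f-bounded)
                                     (BoundedBy-− (BoundedBy-mono (ℕ.m≤m+n Y′ M) G-bounded) τG-bounded)

      residual-sums : ∀ v → Σline (slope d) residual v ≈ 0#
      residual-sums v = begin
        Σline (slope d) residual v                                      ≈⟨ Σline-− (slope d) f (λ x y → G x y - τG x y) v ⟩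
        Σline (slope d) f v - Σline (slope d) (λ x y → G x y - τG x y) v ≈⟨ -‿vanishes (zero-sums v) (begin
          Σline (slope d) (λ x y → G x y - τG x y) v                     ≈⟨ Σline-G-τG (slope d) v ⟩
          Σline (slope d) G v - Σline (slope d) G (v ℤ.- lineIndex (slope d) (+ a d) (b d))
            ≡⟨ ≡.cong (λ w → Σline (slope d) G v - Σline (slope d) G w) v-0≡v ⟩
          Σline (slope d) G v - Σline (slope d) G v                      ≈⟨ -‿inverseʳ _ ⟩
          0#                                                             ∎) ⟩
        0#                                                              ∎
        where
        v-0≡v : v ℤ.- lineIndex (slope d) (+ a d) (b d) ≡ v
        v-0≡v = ≡.trans (≡.cong (ℤ._-_ v) (along d)) (ℤ.+-identityʳ v)

      f≈G-τG : ∀ x y → f x y ≈ G x y - τG x y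
      f≈G-τG x y = x∙y⁻¹≈ε⇒x≈y _ _
        (strip-vanishing d cut fits residual-bounded residual-off-strip residual-sums x y)

      G-zero-sums : ∀ t → Transversal d t → (∀ v → Σline t f v ≈ 0#) → ∀ v → Σline t G v ≈ 0#
      G-zero-sums t transversal f-sums =
        periodic-vanishing setoid (Σline t G) transversal periodic _ (Σline-far t G-bounded)
        where
        periodic : ∀ v → Σline t G v ≈ Σline t G (v ℤ.- lineIndex t (+ a d) (b d))
        periodic v = x∙y⁻¹≈ε⇒x≈y _ _ (begin
          Σline t G v - Σline t G (v ℤ.- lineIndex t (+ a d) (b d)) ≈⟨ Σline-G-τG t v ⟨
          Σline t (λ x y → G x y - τG x y) v                       ≈⟨ Σline-cong t f≈G-τG v ⟨
          Σline t f v                                              ≈⟨ f-sums v ⟩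
          0#                                                       ∎)

    vanishing : ∀ {M} ds → AllPairs (λ d e → Transversal d (slope e)) ds → All (Fits M) ds →
                ∀ {W Y f} → W ℤ.≤ + Y → W ℤ.≤ + sum (map a ds) → Y ℕ.* suc M ℕ.^ length ds ℕ.+ M ℕ.≤ R →
                SupportedIn W Y f → All (λ d → ∀ v → Σline (slope d) f v ≈ 0#) ds → ∀ x y → f x y ≈ 0#
    vanishing [] _ _ _ W≤0 _ supported _ x y with x ℤ.≤? 0ℤ
    ... | yes x≤0 = supported x y (inj₁ x≤0)
    ... | no x≰0  = supported x y (inj₂ (inj₁ (ℤ.≤-<-trans W≤0 (ℤ.≰⇒> x≰0))))
    vanishing {M} (d ∷ ds) (transversal ∷ pairs) ((a≤M , ∣b∣≤M) ∷ fits) {Y = Y} W≤Y W≤Σa budget supported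
              (zero-d ∷ zero-ds) x y =
      trans (f≈G-τG x y) (-‿vanishes (G≈0 x y) (G≈0 (x ℤ.- + a d) (y ℤ.- b d)))
      where
      P = suc M ℕ.^ length ds
      Y′P≡YP′ : (Y ℕ.+ Y ℕ.* M) ℕ.* P ≡ Y ℕ.* suc M ℕ.^ suc (length ds)
      Y′P≡YP′ = ≡.trans (≡.cong (ℕ._* P) (≡.sym (ℕ.*-suc Y M))) (ℕ.*-assoc Y (suc M) P)
      budget′ : (Y ℕ.+ Y ℕ.* M) ℕ.* P ℕ.+ M ℕ.≤ R
      budget′ = ≡.subst (λ z → z ℕ.+ M ℕ.≤ R) (≡.sym Y′P≡YP′) budget
      step-fits : Y ℕ.+ Y ℕ.* M ℕ.+ M ℕ.≤ R
      step-fits = ℕ.≤-trans (ℕ.+-monoˡ-≤ M (ℕ.m≤m*n _ P ⦃ ℕ.m^n≢0 (suc M) (length ds) ⦄)) budget′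
      open Peel d a≤M ∣b∣≤M W≤Y step-fits supported zero-d
      cut≤Σa : cut ℤ.≤ + sum (map a ds)
      cut≤Σa = ≡.subst (cut ℤ.≤_) (cancel (+ a d) (+ sum (map a ds))) (ℤ.+-monoˡ-≤ (ℤ.- + a d) W≤Σa)
        where cancel : ∀ i j → (i ℤ.+ j) ℤ.- i ≡ j
              cancel = solve-∀
      G≈0 : ∀ x y → G x y ≈ 0#
      G≈0 = vanishing ds pairs fits (ℤ.≤-trans cut≤W (ℤ.≤-trans W≤Y (ℤ.+≤+ (ℕ.m≤m+n Y _)))) cut≤Σa budget′ G-supported
              (All.zipWith (λ {e} (transversal-e , zero-e) → G-zero-sums (slope e) transversal-e zero-e)
                           (transversal , zero-ds))

-- The slopes ±k and ±1/k

intS-separated : ∀ k {x₁ y₁ x₂ y₂} → lineIndex (intS k) x₁ y₁ ≡ lineIndex (intS k) x₂ y₂ →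
                 ∣ x₁ ℤ.- x₂ ∣ ℕ.< 1 → x₁ ≡ x₂ × y₁ ≡ y₂
intS-separated k {x₁} {y₁} {x₂} {y₂} same close = x₁≡x₂ , y₁≡y₂
  where
  x₁≡x₂ : x₁ ≡ x₂
  x₁≡x₂ = ℤ.i-j≡0⇒i≡j x₁ x₂ (ℤ.∣i∣≡0⇒i≡0 (ℕ.n<1⇒n≡0 close))
  y₁≡y₂ : y₁ ≡ y₂
  y₁≡y₂ = ℤ.neg-injective (+-cancelˡ (k ℤ.* x₂) _ _ (≡.subst (λ x → k ℤ.* x ℤ.- y₁ ≡ _) x₁≡x₂ same))

invS-separated : ∀ k {x₁ y₁ x₂ y₂} → lineIndex (invS k) x₁ y₁ ≡ lineIndex (invS k) x₂ y₂ →
                 ∣ x₁ ℤ.- x₂ ∣ ℕ.< ∣ k ∣ → x₁ ≡ x₂ × y₁ ≡ y₂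
invS-separated k {x₁} {y₁} {x₂} {y₂} same close = x₁≡x₂ , y₁≡y₂
  where
  rearrange : ∀ x₁ y₁ x₂ y₂ k → x₁ ℤ.- x₂ ≡ ((x₁ ℤ.- k ℤ.* y₁) ℤ.- (x₂ ℤ.- k ℤ.* y₂)) ℤ.+ k ℤ.* (y₁ ℤ.- y₂)
  rearrange = solve-∀
  cancel : ∀ z w → (z ℤ.- z) ℤ.+ w ≡ w
  cancel = solve-∀
  Δx≡kΔy : x₁ ℤ.- x₂ ≡ k ℤ.* (y₁ ℤ.- y₂)
  Δx≡kΔy = ≡.trans (rearrange x₁ y₁ x₂ y₂ k)
             (≡.trans (≡.cong (λ z → (z ℤ.- (x₂ ℤ.- k ℤ.* y₂)) ℤ.+ k ℤ.* (y₁ ℤ.- y₂)) same)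
                      (cancel (x₂ ℤ.- k ℤ.* y₂) (k ℤ.* (y₁ ℤ.- y₂))))
  m*n<m⇒n≡0 : ∀ {m n} → m ℕ.* n ℕ.< m → n ≡ 0
  m*n<m⇒n≡0 {m} {zero}  _     = ≡.refl
  m*n<m⇒n≡0 {m} {suc n} m*n<m = ⊥-elim (ℕ.<⇒≱ m*n<m (ℕ.m≤m*n m (suc n)))
  Δy≡0 : y₁ ℤ.- y₂ ≡ 0ℤ
  Δy≡0 = ℤ.∣i∣≡0⇒i≡0 (m*n<m⇒n≡0 (≡.subst (ℕ._< ∣ k ∣) (≡.trans (≡.cong ∣_∣ Δx≡kΔy) (ℤ.abs-* k _)) close))
  y₁≡y₂ : y₁ ≡ y₂
  y₁≡y₂ = ℤ.i-j≡0⇒i≡j y₁ y₂ Δy≡0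
  x₁≡x₂ : x₁ ≡ x₂
  x₁≡x₂ = ℤ.i-j≡0⇒i≡j x₁ x₂ (≡.trans Δx≡kΔy (≡.trans (≡.cong (ℤ._*_ k) Δy≡0) (ℤ.*-zeroʳ k)))

data Dir : Set where
  int       : ℤ → Dir
  inv⁺ inv⁻ : ℕ → Dir

-- inv⁺ j and inv⁻ j are the slopes 1/(j+2) and -1/(j+2), with steps (j+2, ±1).
direction : Dir → Direction
direction (int k) = record
  { slope = intS k ; a = 1 ; b = k ; 1≤a = ℕ.≤-refl
  ; along = on-line k ; separated = intS-separated k }
  where on-line : ∀ k → k ℤ.* ℤ.1ℤ ℤ.- k ≡ 0ℤ
        on-line = solve-∀
direction (inv⁺ j) = record
  { slope = invS (+ suc (suc j)) ; a = suc (suc j) ; b = ℤ.1ℤ ; 1≤a = s≤s z≤n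
  ; along = on-line (+ suc (suc j)) ; separated = invS-separated (+ suc (suc j)) }
  where on-line : ∀ k → k ℤ.- k ℤ.* ℤ.1ℤ ≡ 0ℤ
        on-line = solve-∀
direction (inv⁻ j) = record
  { slope = invS -[1+ suc j ] ; a = suc (suc j) ; b = ℤ.-1ℤ ; 1≤a = s≤s z≤n
  ; along = on-line (+ suc (suc j)) ; separated = invS-separated -[1+ suc j ] }
  where on-line : ∀ k → k ℤ.- (ℤ.- k) ℤ.* ℤ.-1ℤ ≡ 0ℤ
        on-line = solve-∀

unit-factors : ∀ i k → i ℤ.* k ≡ ℤ.1ℤ ⊎ i ℤ.* k ≡ ℤ.-1ℤ → ∣ i ∣ ≡ 1 × ∣ k ∣ ≡ 1
unit-factors i k unit = ℕ.m*n≡1⇒m≡1 (∣ i ∣) (∣ k ∣) ∣i∣∣k∣≡1 , ℕ.m*n≡1⇒n≡1 (∣ i ∣) (∣ k ∣) ∣i∣∣k∣≡1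
  where
  ∣i∣∣k∣≡1 : ∣ i ∣ ℕ.* ∣ k ∣ ≡ 1
  ∣i∣∣k∣≡1 = ≡.trans (≡.sym (ℤ.abs-* i k)) ([ ≡.cong ∣_∣ , ≡.cong ∣_∣ ]′ unit)

parallel⇒≡ : ∀ d e → lineIndex (slope (direction e)) (+ a (direction d)) (b (direction d)) ≡ 0ℤ → d ≡ e
parallel⇒≡ (int k)  (int k′)  eq =
  ≡.cong int (≡.sym (ℤ.i-j≡0⇒i≡j k′ k (≡.subst (λ z → z ℤ.- k ≡ 0ℤ) (ℤ.*-identityʳ k′) eq)))
parallel⇒≡ (int k)  (inv⁺ j)  eq with () ← proj₁ (unit-factors (+ suc (suc j)) k (inj₁ (≡.sym (ℤ.i-j≡0⇒i≡j _ _ eq))))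
parallel⇒≡ (int k)  (inv⁻ j)  eq with () ← proj₁ (unit-factors -[1+ suc j ] k (inj₁ (≡.sym (ℤ.i-j≡0⇒i≡j _ _ eq))))
parallel⇒≡ (inv⁺ j) (int k)   eq with () ← proj₂ (unit-factors k (+ suc (suc j)) (inj₁ (ℤ.i-j≡0⇒i≡j _ _ eq)))
parallel⇒≡ (inv⁻ j) (int k)   eq with () ← proj₂ (unit-factors k (+ suc (suc j)) (inj₂ (ℤ.i-j≡0⇒i≡j _ _ eq)))
parallel⇒≡ (inv⁺ j) (inv⁺ j′) eq =
  ≡.cong inv⁺ (ℕ.suc-injective (ℕ.suc-injective (ℤ.+-injective
    (≡.trans (ℤ.i-j≡0⇒i≡j _ _ eq) (ℤ.*-identityʳ (+ suc (suc j′)))))))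
parallel⇒≡ (inv⁻ j) (inv⁻ j′) eq =
  ≡.cong inv⁻ (ℕ.suc-injective (ℕ.suc-injective (ℤ.+-injective
    (≡.trans (ℤ.i-j≡0⇒i≡j _ _ eq) (neg*neg (+ suc (suc j′)))))))
  where neg*neg : ∀ k → (ℤ.- k) ℤ.* ℤ.-1ℤ ≡ k
        neg*neg = solve-∀
parallel⇒≡ (inv⁺ j) (inv⁻ j′) eq =
  ⊥-elim (ℕ.1+n≢0 (ℤ.+-injective (≡.trans (≡.sym (as-sum (+ suc (suc j)) (+ suc (suc j′)))) eq)))
  where as-sum : ∀ k k′ → k ℤ.- (ℤ.- k′) ℤ.* ℤ.1ℤ ≡ k ℤ.+ k′
        as-sum = solve-∀
parallel⇒≡ (inv⁻ j) (inv⁺ j′) eq =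
  ⊥-elim (ℕ.1+n≢0 (ℤ.+-injective (≡.trans (≡.sym (as-sum (+ suc (suc j)) (+ suc (suc j′)))) eq)))
  where as-sum : ∀ k k′ → k ℤ.- k′ ℤ.* ℤ.-1ℤ ≡ k ℤ.+ k′
        as-sum = solve-∀

rankᵈ : Dir → ℕ
rankᵈ d = rank (slope (direction d))

_≻_ : Dir → Dir → Set
d ≻ e = rankᵈ e ℕ.< rankᵈ d

≻⇒Transversal : ∀ {d e} → d ≻ e → Transversal (direction d) (slope (direction e))
≻⇒Transversal {d} {e} d≻e parallel = ℕ.<-irrefl (≡.cong rankᵈ (≡.sym (parallel⇒≡ d e parallel))) d≻e

-- All slopes of rank at most 4m + 3 except ∞, in decreasing order of rank.
descending : ℕ → List Dir
descending zero    = int (+ 1) ∷ int -[1+ 0 ] ∷ int (+ 0) ∷ []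
descending (suc m) = int (+ suc (suc m)) ∷ inv⁺ m ∷ int -[1+ suc m ] ∷ inv⁻ m ∷ descending m

descending-linked : ∀ m → Linked _≻_ (descending m)
inv⁻-linked : ∀ m → Linked _≻_ (inv⁻ m ∷ descending m)

descending-linked zero    = ℕ.≤-refl ∷ s≤s z≤n ∷ [-]
descending-linked (suc m) = step ∷ step ∷ step ∷ inv⁻-linked m
  where step : ∀ {c} → 4 ℕ.* m ℕ.+ c ℕ.< 4 ℕ.* m ℕ.+ suc c
        step = ℕ.+-monoʳ-< (4 ℕ.* m) ℕ.≤-refl

inv⁻-linked zero    = ℕ.≤-refl ∷ descending-linked zero
inv⁻-linked (suc m) = ℕ.≤-reflexive (≡.sym (ranks m)) ∷ descending-linked (suc m)
  where ranks : ∀ m → 4 ℕ.* suc m ℕ.+ 4 ≡ suc (4 ℕ.* m ℕ.+ 7)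
        ranks = nsolve-∀

Fits-mono : ∀ {M M′ d} → M ℕ.≤ M′ → Fits M d → Fits M′ d
Fits-mono M≤M′ (a≤M , ∣b∣≤M) = ℕ.≤-trans a≤M M≤M′ , ℕ.≤-trans ∣b∣≤M M≤M′

descending-fits : ∀ m → All (Fits (suc m) ∘ direction) (descending m)
descending-fits zero    = (ℕ.≤-refl , ℕ.≤-refl) ∷ (ℕ.≤-refl , ℕ.≤-refl) ∷ (ℕ.≤-refl , z≤n) ∷ []
descending-fits (suc m) =
  (s≤s z≤n , ℕ.≤-refl) ∷ (ℕ.≤-refl , s≤s z≤n) ∷ (s≤s z≤n , ℕ.≤-refl) ∷ (ℕ.≤-refl , s≤s z≤n) ∷
  All.map (λ {d} → Fits-mono {d = direction d} (ℕ.n≤1+n _)) (descending-fits m)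

width : List Dir → ℕ
width ds = sum (map a (map direction ds))

descending-width : ∀ m → width (descending m) ≡ m ℕ.* m ℕ.+ 5 ℕ.* m ℕ.+ 3
descending-width zero    = ≡.refl
descending-width (suc m) =
  ≡.trans (≡.cong (λ w → 1 ℕ.+ (suc (suc m) ℕ.+ (1 ℕ.+ (suc (suc m) ℕ.+ w)))) (descending-width m)) (widths m)
  where widths : ∀ m → 1 ℕ.+ (suc (suc m) ℕ.+ (1 ℕ.+ (suc (suc m) ℕ.+ (m ℕ.* m ℕ.+ 5 ℕ.* m ℕ.+ 3))))
                       ≡ suc m ℕ.* suc m ℕ.+ 5 ℕ.* suc m ℕ.+ 3
        widths = nsolve-∀

-- The widths of the suffixes of descending (1 + m) starting at -1/(m+2), -(m+2), 1/(m+2), m+2.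
suffix-widths : ∀ m → let q = suc (suc m) ; S = width (descending m) in
  (q ℕ.* q ℕ.+ 2 ℕ.* q ≡ (q ℕ.+ S) ℕ.+ 3) ×
  (q ℕ.* q ℕ.+ 2 ℕ.* q ≡ (1 ℕ.+ (q ℕ.+ S)) ℕ.+ 2) ×
  (q ℕ.* q ℕ.+ 3 ℕ.* q ≡ (q ℕ.+ (1 ℕ.+ (q ℕ.+ S))) ℕ.+ 2) ×
  (q ℕ.* q ℕ.+ 3 ℕ.* q ≡ (1 ℕ.+ (q ℕ.+ (1 ℕ.+ (q ℕ.+ S)))) ℕ.+ 1)
suffix-widths m rewrite descending-width m = w₁ m , w₂ m , w₃ m , w₄ m
  where
  w₁ : ∀ m → suc (suc m) ℕ.* suc (suc m) ℕ.+ 2 ℕ.* suc (suc m) ≡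
             (suc (suc m) ℕ.+ (m ℕ.* m ℕ.+ 5 ℕ.* m ℕ.+ 3)) ℕ.+ 3
  w₁ = nsolve-∀
  w₂ : ∀ m → suc (suc m) ℕ.* suc (suc m) ℕ.+ 2 ℕ.* suc (suc m) ≡
             (1 ℕ.+ (suc (suc m) ℕ.+ (m ℕ.* m ℕ.+ 5 ℕ.* m ℕ.+ 3))) ℕ.+ 2
  w₂ = nsolve-∀
  w₃ : ∀ m → suc (suc m) ℕ.* suc (suc m) ℕ.+ 3 ℕ.* suc (suc m) ≡
             (suc (suc m) ℕ.+ (1 ℕ.+ (suc (suc m) ℕ.+ (m ℕ.* m ℕ.+ 5 ℕ.* m ℕ.+ 3)))) ℕ.+ 2
  w₃ = nsolve-∀
  w₄ : ∀ m → suc (suc m) ℕ.* suc (suc m) ℕ.+ 3 ℕ.* suc (suc m) ≡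
             (1 ℕ.+ (suc (suc m) ℕ.+ (1 ℕ.+ (suc (suc m) ℕ.+ (m ℕ.* m ℕ.+ 5 ℕ.* m ℕ.+ 3))))) ℕ.+ 1
  w₄ = nsolve-∀

≤-∸⇒≤ : ∀ {n T} k {U} → T ≡ U ℕ.+ k → n ℕ.≤ T ℕ.∸ k → n ℕ.≤ U
≤-∸⇒≤ {n} k {U} T≡U+k = ≡.subst (n ℕ.≤_) (≡.trans (≡.cong (ℕ._∸ k) T≡U+k) (ℕ.m+n∸n≡m U k))

-- RK puzzles

module _ (RF : RealField) where
  open LineSums (RealField.+-abelianGroup RF)
  open import Algebra.Properties.AbelianGroup (RealField.+-abelianGroup RF) using (x≈y⇒x∙y⁻¹≈ε; x∙y⁻¹≈ε⇒x≈y)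
  open import Relation.Binary.Reasoning.Setoid setoid

  Σ<-sumFin : ∀ {n} (h : ℕ → Carrier) (g : Fin n → Carrier) → (∀ i → h (toℕ i) ≈ g i) →
              Σ< n h ≈ sumFin RF g
  Σ<-sumFin {zero}  h g eq = refl
  Σ<-sumFin {suc n} h g eq = +-cong (eq Fin.zero) (Σ<-sumFin (h ∘ suc) (g ∘ Fin.suc) (eq ∘ Fin.suc))

  sumFin-zero : ∀ {n} (g : Fin n → Carrier) → (∀ i → g i ≈ 0#) → sumFin RF g ≈ 0#
  sumFin-zero {n} g g≈0 = trans (sym (Σ<-sumFin (λ _ → 0#) g (sym ∘ g≈0))) (Σ<-zero n (λ _ _ → refl))

  lineSum-¬Meets : ∀ {n} (X : Fin n → Fin n → Carrier) t v → ¬ Meets n t v → lineSum RF X t v ≈ 0#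
  lineSum-¬Meets X t v misses = sumFin-zero _ (λ i → sumFin-zero _ (λ j →
    reflexive (when-false (lineOf t i j ℤ.≟ v) (λ on-line → misses (i , j , on-line)) (X i j))))

  module _ (R : ℕ) where
    open Box R

    Σ±-sumFin : ∀ {n} h (g : Fin n → Carrier) → n ℕ.≤ R → VanishesOutside (+ 1) n h →
                (∀ i → h (coord i) ≈ g i) → Σ± R h ≈ sumFin RF g
    Σ±-sumFin {n} h g n≤R vanishes eq =
      trans (Σ⟦⟧-extend {lo₂ = ℤ.- + R} {L₂ = suc (R ℕ.+ R)} ℤ.neg-≤-pos 1+n≤1+R vanishes) (Σ<-sumFin _ g eq)
      where
      1+n≤1+R : + suc n ℤ.≤ ℤ.- + R ℤ.+ + suc (R ℕ.+ R)
      1+n≤1+R = ≡.subst (+ suc n ℤ.≤_) (≡.sym (-R+[1+R+R]≡1+R R)) (ℤ.+≤+ (s≤s n≤R))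

    Σline-pad² : ∀ {n} (X : Fin n → Fin n → Carrier) t v → n ℕ.≤ R → Σline t (pad² X) v ≈ lineSum RF X t v
    Σline-pad² X t v n≤R =
      Σ±-sumFin (λ x → Σ± R (row x)) (λ i → sumFin RF (λ j → when ⌊ lineOf t i j ℤ.≟ v ⌋ (X i j))) n≤R
      (λ x out → Σ±-zero (λ y → when-vanishes ⌊ lineIndex t x y ℤ.≟ v ⌋
                                  (pad-outside (λ i → pad (X i) y) x (outside-[1,n] out))))
      (λ i → Σ±-sumFin (row (coord i)) (λ j → when ⌊ lineOf t i j ℤ.≟ v ⌋ (X i j)) n≤R
        (λ y out → when-vanishes ⌊ lineIndex t (coord i) y ℤ.≟ v ⌋
          (trans (reflexive (padℕ-toℕ (λ i → pad (X i) y) i)) (pad-outside (X i) y (outside-[1,n] out))))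
        (λ j → reflexive (≡.cong (when ⌊ lineOf t i j ℤ.≟ v ⌋) (pad²-coord X i j))))
      where
      row : ℤ → ℤ → Carrier
      row x y = when ⌊ lineIndex t x y ℤ.≟ v ⌋ (pad² X x y)

  allUnique : ∀ n M ds s → AllPairs (λ d e → Transversal d (slope e)) ds → All (Fits M) ds →
              All (λ d → slope d ⪯ s) ds → n ℕ.≤ sum (map a ds) → AllUnique RF n s
  allUnique n M ds s transversal fits below n≤Σa c X Y solves-X solves-Y i j =
    x∙y⁻¹≈ε⇒x≈y _ _ (begin
      X i j - Y i j                        ≡⟨ ≡.cong₂ _-_ (pad²-coord X i j) (pad²-coord Y i j) ⟨
      D (coord i) (coord j)                ≈⟨ vanishing ds transversal fits ℤ.≤-refl (ℤ.+≤+ n≤Σa) ℕ.≤-refl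
                                                 D-supported zero-sums (coord i) (coord j) ⟩
      0#                                   ∎)
    where
    R = n ℕ.* suc M ℕ.^ length ds ℕ.+ M
    open Box R
    n≤R : n ℕ.≤ R
    n≤R = ℕ.≤-trans (ℕ.m≤m*n n _ ⦃ ℕ.m^n≢0 (suc M) (length ds) ⦄) (ℕ.m≤m+n _ M)
    D : ℤ → ℤ → Carrier
    D x y = pad² X x y - pad² Y x y
    D-supported : SupportedIn (+ n) n D
    D-supported x y out = -‿vanishes (pad²-supported X x y out) (pad²-supported Y x y out)
    zero-sums : All (λ d → ∀ v → Σline (slope d) D v ≈ 0#) ds
    zero-sums = All.map (λ {d} t⪯s v → trans (Σline-− (slope d) (pad² X) (pad² Y) v)
                          (trans (+-cong (Σline-pad² R X (slope d) v n≤R) (-‿cong (Σline-pad² R Y (slope d) v n≤R)))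
                                 (difference (slope d) t⪯s v))) below
      where
      difference : ∀ t → t ⪯ s → ∀ v → lineSum RF X t v - lineSum RF Y t v ≈ 0#
      difference t t⪯s v with Fin.any? (λ i → Fin.any? (λ j → lineOf t i j ℤ.≟ v))
      ... | yes meets = x≈y⇒x∙y⁻¹≈ε (trans (solves-X t t⪯s v meets) (sym (solves-Y t t⪯s v meets)))
      ... | no misses = -‿vanishes (lineSum-¬Meets X t v misses) (lineSum-¬Meets Y t v misses)

  unique-descending : ∀ n M d ds → Linked _≻_ (d ∷ ds) → All (Fits M ∘ direction) (d ∷ ds) →
                      n ℕ.≤ width (d ∷ ds) → AllUnique RF n (slope (direction d))
  unique-descending n M d ds linked fits n≤Σa =
    allUnique n M (map direction (d ∷ ds)) (slope (direction d))
      (AllPairs.map⁺ (AllPairs.map (λ {d} {e} → ≻⇒Transversal {d} {e}) pairs))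
      (All.map⁺ fits)
      (All.map⁺ below)
      n≤Σa
    where
    pairs : AllPairs _≻_ (d ∷ ds)
    pairs = Linked⇒AllPairs (λ d≻e e≻f → ℕ.<-trans e≻f d≻e) linked
    below : All (λ e → rankᵈ e ℕ.≤ rankᵈ d) (d ∷ ds)
    below = ℕ.≤-refl ∷ All.map ℕ.<⇒≤ (AllPairs.head pairs)


theorem3 : (R : RealField) (n q : ℕ) → 1 ℕ.≤ n → 2 ℕ.≤ q →
    ((n ℕ.≤ q ℕ.* q ℕ.+ 2 ℕ.* q ℕ.∸ 3 → AllUnique R n (invS (ℤ.- (+ q)))) ×
     (n ℕ.≤ q ℕ.* q ℕ.+ 2 ℕ.* q ℕ.∸ 2 → AllUnique R n (intS (ℤ.- (+ q)))) ×
     (n ℕ.≤ q ℕ.* q ℕ.+ 3 ℕ.* q ℕ.∸ 2 → AllUnique R n (invS (+ q))) ×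
     (n ℕ.≤ q ℕ.* q ℕ.+ 3 ℕ.* q ℕ.∸ 1 → AllUnique R n (intS (+ q))))
theorem3 R n (suc (suc m)) _ (s≤s (s≤s z≤n)) =
  (unique-descending R n q _ _ linked₁ fits₁ ∘ ≤-∸⇒≤ 3 w₁) ,
  (unique-descending R n q _ _ linked₂ fits₂ ∘ ≤-∸⇒≤ 2 w₂) ,
  (unique-descending R n q _ _ linked₃ fits₃ ∘ ≤-∸⇒≤ 2 w₃) ,
  (unique-descending R n q _ _ linked₄ fits₄ ∘ ≤-∸⇒≤ 1 w₄)
  where
  q = suc (suc m)
  linked₄ = descending-linked (suc m)
  linked₃ = Linked.tail linked₄
  linked₂ = Linked.tail linked₃
  linked₁ = Linked.tail linked₂
  fits₄ = descending-fits (suc m)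
  fits₃ = All.tail fits₄
  fits₂ = All.tail fits₃
  fits₁ = All.tail fits₂
  widths = suffix-widths m
  w₁ = proj₁ widths
  w₂ = proj₁ (proj₂ widths)
  w₃ = proj₁ (proj₂ (proj₂ widths))
  w₄ = proj₂ (proj₂ (proj₂ widths))
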